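{- Let $C$ be a program and $Q$ a predicate on states. Let $P^w$ be the weakest precondition for $C$ and $Q$ with respect to Hoare triples and $P^s$ the strongest precondition for $C$ and $Q$ with respect to access Hoare triples. Then $P^s$ equals the intersection of $P^w$ with the set of states $s$ on which $C$ terminates (i.e. such that $\exists s'\, C:s\Rightarrow s'$).
   Context: States are mappings from variables to values; programs are those of the while language (skip, assignment, sequential composition, if-then-else, while), with deterministic big-step execution relation $C:s\Rightarrow s'$ meaning execution of $C$ from $s$ terminates in $s'$. The Hoare triple $\{P\}\,C\,\{Q\}$ is valid iff $\forall s,s'\,[\,C:s\Rightarrow s'\wedge P(s)\rightarrow Q(s')\,]$; the access Hoare triple $\langle P\rangle\,C\,\langle Q\rangle$ is valid iff $\forall s,s'\,[\,C:s\Rightarrow s'\wedge Q(s')\rightarrow P(s)\,]$. A weakest precondition for $C,Q$ w.r.t. Hoare triples is a predicate $P'$ with: for all $P$, $\{P\}C\{Q\}$ valid iff $P\rightarrow P'$. A strongest precondition for $C,Q$ w.r.t. access Hoare triples is a predicate $P'$ with: for all $P$, $\langle P\rangle C\langle Q\rangle$ valid iff $P'\rightarrow P$. Both are unique (as predicates/sets of states). -}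

module Defs where

open import Data.Nat using (ℕ; _≟_)
open import Relation.Nullary using (yes; no)
open import Data.Integer using (ℤ; _+_; _-_; _*_; _≤ᵇ_)
open import Data.Bool using (Bool; true; false; not; _∧_)
open import Data.Product using (_×_; ∃)
open import Level using (0ℓ)
open import Relation.Binary.PropositionalEquality using (_≡_)

Var : Set
Var = ℕ

State : Set
State = Var → ℤ

update : State → Var → ℤ → State
update s x v y with x ≟ y
... | yes _ = v
... | no  _ = s y

data AExp : Set where
  num  : ℤ → AExp
  var  : Var → AExp
  plus minus times : AExp → AExp → AExp

data BExp : Set where
  bool : Bool → BExp
  bnot : BExp → BExp
  band : BExp → BExp → BExp
  leq  : AExp → AExp → BExp

aval : AExp → State → ℤ
aval (num n) s = n
aval (var x) s = s x
aval (plus a b) s = aval a s + aval b s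
aval (minus a b) s = aval a s - aval b s
aval (times a b) s = aval a s * aval b s

bval : BExp → State → Bool
bval (bool b) s = b
bval (bnot b) s = not (bval b s)
bval (band a b) s = bval a s ∧ bval b s
bval (leq a b) s = aval a s ≤ᵇ aval b s

data Com : Set where
  SKIP  : Com
  _::=_ : Var → AExp → Com
  _⨾_  : Com → Com → Com
  IF_THEN_ELSE_ : BExp → Com → Com → Com
  WHILE_DO_ : BExp → Com → Com

data _∶_⇒_ : Com → State → State → Set where
  Skip : ∀ {s} → SKIP ∶ s ⇒ s
  Assign : ∀ {x a s} → (x ::= a) ∶ s ⇒ update s x (aval a s)
  Seq : ∀ {c₁ c₂ s₁ s₂ s₃} → c₁ ∶ s₁ ⇒ s₂ → c₂ ∶ s₂ ⇒ s₃ → (c₁ ⨾ c₂) ∶ s₁ ⇒ s₃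
  IfTrue : ∀ {b c₁ c₂ s t} → bval b s ≡ true → c₁ ∶ s ⇒ t → (IF b THEN c₁ ELSE c₂) ∶ s ⇒ t
  IfFalse : ∀ {b c₁ c₂ s t} → bval b s ≡ false → c₂ ∶ s ⇒ t → (IF b THEN c₁ ELSE c₂) ∶ s ⇒ t
  WhileFalse : ∀ {b c s} → bval b s ≡ false → (WHILE b DO c) ∶ s ⇒ s
  WhileTrue : ∀ {b c s₁ s₂ s₃} → bval b s₁ ≡ true → c ∶ s₁ ⇒ s₂ →
              (WHILE b DO c) ∶ s₂ ⇒ s₃ → (WHILE b DO c) ∶ s₁ ⇒ s₃

Assn : Set₁
Assn = State → Set

HoareValid : Assn → Com → Assn → Set
HoareValid P C Q = ∀ s s' → C ∶ s ⇒ s' → P s → Q s'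

AccessValid : Assn → Com → Assn → Set
AccessValid P C Q = ∀ s s' → C ∶ s ⇒ s' → Q s' → P s

_⟹_ : Assn → Assn → Set
P ⟹ Q = ∀ s → P s → Q s

_≐_ : Assn → Assn → Set
P ≐ Q = (P ⟹ Q) × (Q ⟹ P)

IsWeakestPre : Com → Assn → Assn → Set₁
IsWeakestPre C Q P' = ∀ (P : Assn) → (HoareValid P C Q → (P ⟹ P')) × ((P ⟹ P') → HoareValid P C Q)

IsStrongestPre : Com → Assn → Assn → Set₁
IsStrongestPre C Q P' = ∀ (P : Assn) → (AccessValid P C Q → (P' ⟹ P)) × ((P' ⟹ P) → AccessValid P C Q)

Terminates : Com → State → Set
Terminates C s = ∃ λ s' → C ∶ s ⇒ s'

-- The weakest Hoare precondition is the weakest liberal precondition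
-- wlp s = ∀ s' → C ∶ s ⇒ s' → Q s', and the strongest access precondition is the
-- preimage pre s = ∃ s' → C ∶ s ⇒ s' × Q s'; both are forced by the universal
-- properties, tested against each other and against themselves. Since execution is
-- deterministic, a terminating state lies in pre exactly when it lies in wlp.
module Submission where

open import Defs
open import Data.Product using (_×_; _,_; proj₁; proj₂; ∃)
open import Relation.Binary.PropositionalEquality using (_≡_; refl; trans; sym; subst)

⇒-deterministic : ∀ {C s t u} → C ∶ s ⇒ t → C ∶ s ⇒ u → t ≡ u
⇒-deterministic Skip Skip = refl
⇒-deterministic Assign Assign = refl
⇒-deterministic (Seq a b) (Seq a' b') with ⇒-deterministic a a'
... | refl = ⇒-deterministic b b'
⇒-deterministic (IfTrue _ a) (IfTrue _ a') = ⇒-deterministic a a'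
⇒-deterministic (IfTrue e _) (IfFalse e' _) with trans (sym e) e'
... | ()
⇒-deterministic (IfFalse e _) (IfTrue e' _) with trans (sym e) e'
... | ()
⇒-deterministic (IfFalse _ a) (IfFalse _ a') = ⇒-deterministic a a'
⇒-deterministic (WhileFalse _) (WhileFalse _) = refl
⇒-deterministic (WhileFalse e) (WhileTrue e' _ _) with trans (sym e) e'
... | ()
⇒-deterministic (WhileTrue e _ _) (WhileFalse e') with trans (sym e) e'
... | ()
⇒-deterministic (WhileTrue _ a b) (WhileTrue _ a' b') with ⇒-deterministic a a'
... | refl = ⇒-deterministic b b'

⟹-refl : {P : Assn} → P ⟹ P
⟹-refl _ p = p

≐-trans : {P Q R : Assn} → P ≐ Q → Q ≐ R → P ≐ R
≐-trans (pq , qp) (qr , rq) = (λ s p → qr s (pq s p)) , (λ s r → qp s (rq s r))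

≐-sym : {P Q : Assn} → P ≐ Q → Q ≐ P
≐-sym (pq , qp) = qp , pq

≐-×-congˡ : {P P' R : Assn} → P ≐ P' → (λ s → P s × R s) ≐ (λ s → P' s × R s)
≐-×-congˡ (pp' , p'p) = (λ { s (p , r) → pp' s p , r }) , (λ { s (p' , r) → p'p s p' , r })

wlp : Com → Assn → Assn
wlp C Q s = ∀ s' → C ∶ s ⇒ s' → Q s'

pre : Com → Assn → Assn
pre C Q s = ∃ λ s' → C ∶ s ⇒ s' × Q s'

hoareValid-wlp : (C : Com) (Q : Assn) → HoareValid (wlp C Q) C Q
hoareValid-wlp C Q s s' d w = w s' d

accessValid-pre : (C : Com) (Q : Assn) → AccessValid (pre C Q) C Q
accessValid-pre C Q s s' d q = s' , d , q

weakestPre≐wlp : ∀ {C Q Pw} → IsWeakestPre C Q Pw → Pw ≐ wlp C Q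
weakestPre≐wlp {C} {Q} {Pw} wp =
    (λ s pw s' d → hoareValid-Pw s s' d pw)
  , proj₁ (wp (wlp C Q)) (hoareValid-wlp C Q)
  where
  hoareValid-Pw : HoareValid Pw C Q
  hoareValid-Pw = proj₂ (wp Pw) ⟹-refl

strongestPre≐pre : ∀ {C Q Ps} → IsStrongestPre C Q Ps → Ps ≐ pre C Q
strongestPre≐pre {C} {Q} {Ps} sp =
    proj₁ (sp (pre C Q)) (accessValid-pre C Q)
  , (λ { s (s' , d , q) → accessValid-Ps s s' d q })
  where
  accessValid-Ps : AccessValid Ps C Q
  accessValid-Ps = proj₂ (sp Ps) ⟹-refl

pre≐wlp×terminates : (C : Com) (Q : Assn) →
  pre C Q ≐ (λ s → wlp C Q s × Terminates C s)
pre≐wlp×terminates C Q =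
    (λ { s (s' , d , q) → (λ u d' → subst Q (⇒-deterministic d d') q) , (s' , d) })
  , (λ { s (w , (s' , d)) → s' , d , w s' d })

corollary5p5 : (C : Com) (Q Pw Ps : Assn) →
    IsWeakestPre C Q Pw → IsStrongestPre C Q Ps →
    Ps ≐ (λ s → Pw s × Terminates C s)
corollary5p5 C Q Pw Ps wp sp =
  ≐-trans (strongestPre≐pre sp)
    (≐-trans (pre≐wlp×terminates C Q)
      (≐-×-congˡ (≐-sym (weakestPre≐wlp wp))))
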